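{- Let $G$ be a digraph, $\mathcal B$ a bramble in $G$ of order $k\cdot(k+2)$, and $P$ a (directed) path intersecting every $B\in\mathcal B$. Then there is a set $A\subseteq V(P)$ of order $k$ which is well linked.
   Context: A bramble in a digraph $G$ is a set $\mathcal B$ of strongly connected subgraphs such that any two of its elements intersect or are joined by an edge in each direction. A cover of $\mathcal B$ is a vertex set meeting every element of $\mathcal B$; the order of $\mathcal B$ is the minimum size of a cover. A linkage is a set of pairwise vertex-disjoint directed paths; an $X$-$Y$ linkage consists of paths from $X$ to $Y$; its order is its number of paths. A set $A\subseteq V(G)$ is well linked if for all $X,Y\subseteq A$ with $|X|=|Y|=r$ there is an $X$-$Y$ linkage of order $r$. -}

module Defs where

open import Data.Nat using (ℕ; _≤_)
open import Data.Bool using (Bool; true)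
open import Data.Fin using (Fin)
open import Data.Fin.Subset using (Subset; _∈_; _⊆_; ∣_∣)
open import Data.List using (List; []; _∷_; length)
open import Data.List.Membership.Propositional using () renaming (_∈_ to _∈ₗ_)
open import Data.List.Relation.Unary.All using (All)
open import Data.List.Relation.Unary.AllPairs using (AllPairs)
open import Data.List.Relation.Unary.Linked using (Linked)
open import Data.List.Relation.Unary.Unique.Propositional using (Unique)
open import Data.Product using (Σ; ∃; ∃-syntax; _×_)
open import Data.Sum using (_⊎_)
open import Relation.Binary.PropositionalEquality using (_≡_)
open import Relation.Nullary using (¬_)

record Digraph (n : ℕ) : Set where
  field
    adj : Fin n → Fin n → Bool

open Digraph public

module _ {n : ℕ} (G : Digraph n) where

  Edge : Fin n → Fin n → Set
  Edge u v = adj G u v ≡ true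

  record Subgraph : Set where
    field
      V  : Subset n
      E  : Fin n → Fin n → Bool
      E⊆ : ∀ u v → E u v ≡ true → Edge u v × u ∈ V × v ∈ V

  open Subgraph public

  data Reach (H : Subgraph) : Fin n → Fin n → Set where
    here : ∀ {u} → Reach H u u
    step : ∀ {u w v} → E H u w ≡ true → Reach H w v → Reach H u v

  StronglyConnected : Subgraph → Set
  StronglyConnected H =
    (∃[ v ] v ∈ V H) × (∀ u v → u ∈ V H → v ∈ V H → Reach H u v)

  Touch : Subgraph → Subgraph → Set
  Touch B B' =
    (∃[ v ] (v ∈ V B × v ∈ V B'))
    ⊎ ((∃[ u ] ∃[ v ] (u ∈ V B × v ∈ V B' × Edge u v))
       × (∃[ u ] ∃[ v ] (u ∈ V B' × v ∈ V B × Edge u v)))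

  IsBramble : List Subgraph → Set
  IsBramble 𝓑 = All StronglyConnected 𝓑 × (∀ B B' → B ∈ₗ 𝓑 → B' ∈ₗ 𝓑 → Touch B B')

  IsCover : List Subgraph → Subset n → Set
  IsCover 𝓑 C = ∀ B → B ∈ₗ 𝓑 → ∃[ v ] (v ∈ C × v ∈ V B)

  HasOrder : List Subgraph → ℕ → Set
  HasOrder 𝓑 m = (∃[ C ] (IsCover 𝓑 C × ∣ C ∣ ≡ m)) × (∀ C → IsCover 𝓑 C → m ≤ ∣ C ∣)

  lastOf : Fin n → List (Fin n) → Fin n
  lastOf x [] = x
  lastOf x (y ∷ ys) = lastOf y ys

  record Path : Set where
    field
      first  : Fin n
      rest   : List (Fin n)
      unique : Unique (first ∷ rest)
      linked : Linked Edge (first ∷ rest)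

  open Path public

  verts : Path → List (Fin n)
  verts P = first P ∷ rest P

  final : Path → Fin n
  final P = lastOf (first P) (rest P)

  VertexDisjoint : Path → Path → Set
  VertexDisjoint P Q = ∀ x → x ∈ₗ verts P → ¬ (x ∈ₗ verts Q)

  IsLinkage : Subset n → Subset n → List Path → Set
  IsLinkage X Y L =
    AllPairs VertexDisjoint L × All (λ P → first P ∈ X × final P ∈ Y) L

  WellLinked : Subset n → Set
  WellLinked A = ∀ X Y → X ⊆ A → Y ⊆ A → ∣ X ∣ ≡ ∣ Y ∣ →
    ∃[ L ] (IsLinkage X Y L × length L ≡ ∣ X ∣)

module Submission where

-- Greedily cut P into T₀ a₁ T₁ … a_k T_k so that the bramble elements meeting each segment Tᵢ
-- cannot be covered by fewer than k vertices; the order k(k+1) + k of the bramble pays for the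
-- k + 1 segments and the k cut vertices. Let A = {a₁, …, a_k}. If X, Y ⊆ A of equal size cannot
-- be linked, Menger's theorem, proved by induction on the number of edges, yields a separator S
-- with ∣ S ∣ < ∣ X ∣ ≤ k. Counting gives aᵢ ∈ X with aᵢTᵢ disjoint from S and a_j ∈ Y with
-- T_{j−1}a_j disjoint from S; Tᵢ and T_{j−1} meet bramble elements B, B′ avoiding S, and as B, B′
-- touch, aᵢ → Tᵢ → B → B′ → T_{j−1} → a_j is a walk avoiding S, a contradiction.

open import Defs
open import Data.Bool using (true; false)
import Data.Bool as Bool
open import Data.Empty using (⊥; ⊥-elim)
open import Data.Fin using (Fin)
import Data.Fin as Fin
import Data.Fin.Properties as Fin
import Data.Vec as Vec
open import Data.Fin.Subset as Sub using (Subset; _∈_; _∉_; _∪_; _∩_; ⁅_⁆; _-_; ∣_∣)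
  renaming (_⊆_ to _⊆ₛ_)
open import Data.Fin.Subset.Properties
open import Data.List using (List; []; _∷_; _++_; length; map; filter; take; allFin; cartesianProduct)
open import Data.List.Properties using (length-map; length-take; ++-assoc; ++-identityʳ)
open import Data.List.Membership.Propositional using (find; lose) renaming (_∈_ to _∈ₗ_; _∉_ to _∉ₗ_)
open import Data.List.Membership.Propositional.Properties
  using (∈-++⁻; ∈-++⁺ˡ; ∈-++⁺ʳ; ∈-map⁻; ∈-filter⁺; ∈-filter⁻; ∈-allFin; ∈-cartesianProduct⁺)
import Data.List.Membership.DecPropositional as DecMembership
open import Data.List.Relation.Binary.Disjoint.Propositional using (Disjoint)
open import Data.List.Relation.Binary.Subset.Propositional using () renaming (_⊆_ to _⊆ₗ_)
open import Data.List.Relation.Unary.Any as Any using (Any; here; there)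
import Data.List.Relation.Unary.Any.Properties as Any
open import Data.List.Relation.Unary.All as All using (All; []; _∷_)
import Data.List.Relation.Unary.All.Properties as All
open import Data.List.Relation.Unary.AllPairs as AllPairs using (AllPairs; []; _∷_)
import Data.List.Relation.Unary.AllPairs.Properties as AllPairs
open import Data.List.Relation.Unary.Linked as Linked using (Linked; []; [-]; _∷_)
open import Data.List.Relation.Unary.Unique.Propositional using (Unique)
import Data.List.Relation.Unary.Unique.Propositional.Properties as Unique
open import Data.Nat using (ℕ; zero; suc; _+_; _*_; _≤_; _<_; z≤n; s≤s; _≤?_)
open import Data.Nat.Properties
open import Data.Product using (Σ; ∃; ∃-syntax; _×_; _,_; proj₁; proj₂)
open import Data.Sum using (_⊎_; inj₁; inj₂; [_,_]′)
open import Function using (_∘_; id)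
open import Relation.Binary.PropositionalEquality
open import Relation.Nullary using (¬_; Dec; yes; no)
open import Relation.Nullary.Decidable using (_×-dec_; _→-dec_; ¬?; decidable-stable)
open import Relation.Unary using (Decidable)

∣p∪q∣≤∣p∣+∣q∣ : ∀ {n} (p q : Subset n) → ∣ p ∪ q ∣ ≤ ∣ p ∣ + ∣ q ∣
∣p∪q∣≤∣p∣+∣q∣ Vec.[] Vec.[] = z≤n
∣p∪q∣≤∣p∣+∣q∣ (true Vec.∷ p) (true Vec.∷ q) =
  s≤s (≤-trans (∣p∪q∣≤∣p∣+∣q∣ p q) (≤-trans (n≤1+n _) (≤-reflexive (sym (+-suc _ _)))))
∣p∪q∣≤∣p∣+∣q∣ (true Vec.∷ p) (false Vec.∷ q) = s≤s (∣p∪q∣≤∣p∣+∣q∣ p q)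
∣p∪q∣≤∣p∣+∣q∣ (false Vec.∷ p) (true Vec.∷ q) =
  ≤-trans (s≤s (∣p∪q∣≤∣p∣+∣q∣ p q)) (≤-reflexive (sym (+-suc _ _)))
∣p∪q∣≤∣p∣+∣q∣ (false Vec.∷ p) (false Vec.∷ q) = ∣p∪q∣≤∣p∣+∣q∣ p q

module _ {n : ℕ} where

  ∣p∪⁅x⁆∣≤1+∣p∣ : (p : Subset n) (x : Fin n) → ∣ p ∪ ⁅ x ⁆ ∣ ≤ suc ∣ p ∣
  ∣p∪⁅x⁆∣≤1+∣p∣ p x = begin
    ∣ p ∪ ⁅ x ⁆ ∣     ≤⟨ ∣p∪q∣≤∣p∣+∣q∣ p ⁅ x ⁆ ⟩
    ∣ p ∣ + ∣ ⁅ x ⁆ ∣ ≡⟨ cong (∣ p ∣ +_) (∣⁅x⁆∣≡1 x) ⟩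
    ∣ p ∣ + 1         ≡⟨ +-comm ∣ p ∣ 1 ⟩
    suc ∣ p ∣         ∎
    where open ≤-Reasoning

  fromList : List (Fin n) → Subset n
  fromList []       = Sub.⊥
  fromList (x ∷ xs) = ⁅ x ⁆ ∪ fromList xs

  ∈-fromList⁺ : ∀ {x} xs → x ∈ₗ xs → x ∈ fromList xs
  ∈-fromList⁺ (y ∷ xs) (here refl) = p⊆p∪q (fromList xs) (x∈⁅x⁆ y)
  ∈-fromList⁺ (y ∷ xs) (there x∈) = q⊆p∪q ⁅ y ⁆ (fromList xs) (∈-fromList⁺ xs x∈)

  ∈-fromList⁻ : ∀ {x} xs → x ∈ fromList xs → x ∈ₗ xs
  ∈-fromList⁻ [] x∈ = ⊥-elim (∉⊥ x∈)
  ∈-fromList⁻ (y ∷ xs) x∈ with x∈p∪q⁻ ⁅ y ⁆ (fromList xs) x∈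
  ... | inj₁ x∈⁅y⁆ = here (x∈⁅y⁆⇒x≡y y x∈⁅y⁆)
  ... | inj₂ x∈xs  = there (∈-fromList⁻ xs x∈xs)

  ∣fromList∣≤length : ∀ xs → ∣ fromList xs ∣ ≤ length xs
  ∣fromList∣≤length [] = ≤-reflexive (∣⊥∣≡0 n)
  ∣fromList∣≤length (x ∷ xs) = begin
    ∣ ⁅ x ⁆ ∪ fromList xs ∣          ≤⟨ ∣p∪q∣≤∣p∣+∣q∣ ⁅ x ⁆ (fromList xs) ⟩
    ∣ ⁅ x ⁆ ∣ + ∣ fromList xs ∣      ≡⟨ cong (_+ ∣ fromList xs ∣) (∣⁅x⁆∣≡1 x) ⟩
    suc ∣ fromList xs ∣              ≤⟨ s≤s (∣fromList∣≤length xs) ⟩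
    suc (length xs)                  ∎
    where open ≤-Reasoning

  ∣p∣≤length : (p : Subset n) (xs : List (Fin n)) → (∀ {x} → x ∈ p → x ∈ₗ xs) → ∣ p ∣ ≤ length xs
  ∣p∣≤length p xs p⊆xs = ≤-trans (p⊆q⇒∣p∣≤∣q∣ (∈-fromList⁺ xs ∘ p⊆xs)) (∣fromList∣≤length xs)

  elements : Subset n → List (Fin n)
  elements p = filter (_∈? p) (allFin n)

  elements-unique : ∀ p → Unique (elements p)
  elements-unique p = Unique.filter⁺ (_∈? p) (Unique.allFin⁺ n)

  elements⊆ : ∀ p → All (_∈ p) (elements p)
  elements⊆ p = All.all-filter (_∈? p) (allFin n)

  ∈-elements⁺ : ∀ p {x} → x ∈ p → x ∈ₗ elements p
  ∈-elements⁺ p {x} = ∈-filter⁺ (_∈? p) (∈-allFin x)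

  Unique⇒length≤∣p∣ : (p : Subset n) {xs : List (Fin n)} → Unique xs → All (_∈ p) xs → length xs ≤ ∣ p ∣
  Unique⇒length≤∣p∣ p {[]} _ _ = z≤n
  Unique⇒length≤∣p∣ p {x ∷ xs} (x∉xs ∷ xs!) (x∈p ∷ xs⊆p) =
    ≤-trans (s≤s (Unique⇒length≤∣p∣ (p - x) xs! (All.zipWith removeX (x∉xs , xs⊆p)))) (x∈p⇒∣p-x∣<∣p∣ x∈p)
    where
    removeX : ∀ {y} → x ≢ y × y ∈ p → y ∈ p - x
    removeX (x≢y , y∈p) = x∈p∧x≢y⇒x∈p-y y∈p (x≢y ∘ sym)

  Unique∧∣p∣≤length⇒p⊆ : (p : Subset n) {xs : List (Fin n)} → Unique xs → All (_∈ p) xs →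
                          ∣ p ∣ ≤ length xs → ∀ {x} → x ∈ p → x ∈ₗ xs
  Unique∧∣p∣≤length⇒p⊆ p {xs} xs! xs⊆p ∣p∣≤ {x} x∈p with DecMembership._∈?_ Fin._≟_ x xs
  ... | yes x∈xs = x∈xs
  ... | no  x∉xs = ⊥-elim (<⇒≱ (x∈p⇒∣p-x∣<∣p∣ x∈p)
                     (≤-trans ∣p∣≤ (Unique⇒length≤∣p∣ (p - x) xs! (All.tabulate inP-x))))
    where
    inP-x : ∀ {y} → y ∈ₗ xs → y ∈ p - x
    inP-x y∈xs = x∈p∧x≢y⇒x∈p-y (All.lookup xs⊆p y∈xs) (λ { refl → x∉xs y∈xs })

module _ {A : Set} where

  module _ {R : A → A → Set} where

    Linked-++⁻ˡ : ∀ xs {ys} → Linked R (xs ++ ys) → Linked R xs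
    Linked-++⁻ˡ []           _         = []
    Linked-++⁻ˡ (x ∷ [])     _         = [-]
    Linked-++⁻ˡ (x ∷ y ∷ xs) (r ∷ rs)  = r ∷ Linked-++⁻ˡ (y ∷ xs) rs

    Linked-++⁻ʳ : ∀ xs {ys} → Linked R (xs ++ ys) → Linked R ys
    Linked-++⁻ʳ []       rs = rs
    Linked-++⁻ʳ (x ∷ xs) rs = Linked-++⁻ʳ xs (Linked.tail rs)

    Linked-join : ∀ xs {t ys} → Linked R (xs ++ t ∷ []) → Linked R (t ∷ ys) → Linked R (xs ++ t ∷ ys)
    Linked-join []           _          rs′ = rs′
    Linked-join (x ∷ [])     (r ∷ [-])  rs′ = r ∷ rs′
    Linked-join (x ∷ y ∷ xs) (r ∷ rs)   rs′ = r ∷ Linked-join (y ∷ xs) rs rs′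

    AllPairs-lookup₂ : ∀ {xs x y} → AllPairs R xs → x ∈ₗ xs → y ∈ₗ xs → x ≡ y ⊎ R x y ⊎ R y x
    AllPairs-lookup₂ (rs ∷ _)   (here refl) (here refl) = inj₁ refl
    AllPairs-lookup₂ (rs ∷ _)   (here refl) (there y∈)  = inj₂ (inj₁ (All.lookup rs y∈))
    AllPairs-lookup₂ (rs ∷ _)   (there x∈)  (here refl) = inj₂ (inj₂ (All.lookup rs x∈))
    AllPairs-lookup₂ (_ ∷ rss)  (there x∈)  (there y∈)  = AllPairs-lookup₂ rss x∈ y∈

  Unique-++⁻ : ∀ xs {ys : List A} → Unique (xs ++ ys) → Unique xs × Unique ys × Disjoint xs ys
  Unique-++⁻ []       ys! = [] , ys! , λ ()
  Unique-++⁻ (x ∷ xs) {ys} (x∉ ∷ xsys!) with Unique-++⁻ xs xsys!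
  ... | xs! , ys! , xs#ys = All.++⁻ˡ xs x∉ ∷ xs! , ys! , x∷xs#ys
    where
    x∷xs#ys : Disjoint (x ∷ xs) ys
    x∷xs#ys (here refl , v∈ys) = All.lookup (All.++⁻ʳ xs x∉) v∈ys refl
    x∷xs#ys (there v∈xs , v∈ys) = xs#ys (v∈xs , v∈ys)

  module _ {P : A → Set} (P? : Decidable P) where

    FirstSplit LastSplit : List A → Set
    FirstSplit xs = ∃[ α ] ∃[ t ] ∃[ ρ ] (xs ≡ α ++ t ∷ ρ × P t × All (¬_ ∘ P) α)
    LastSplit  xs = ∃[ ρ ] ∃[ t ] ∃[ δ ] (xs ≡ ρ ++ t ∷ δ × P t × All (¬_ ∘ P) δ)

    split-first : ∀ {xs} → Any P xs → FirstSplit xs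
    split-first {x ∷ xs} any with P? x
    ... | yes px = [] , x , xs , refl , px , []
    ... | no ¬px with any
    ...   | here px = ⊥-elim (¬px px)
    ...   | there any′ with split-first any′
    ...     | α , t , ρ , refl , pt , ¬Pα = x ∷ α , t , ρ , refl , pt , ¬px ∷ ¬Pα

    split-last : ∀ {xs} → Any P xs → LastSplit xs
    split-last {x ∷ xs} any with Any.any? P? xs
    ... | yes any′ with split-last any′
    ...   | ρ , t , δ , refl , pt , ¬Pδ = x ∷ ρ , t , δ , refl , pt , ¬Pδ
    split-last {x ∷ xs} (here px)   | no ¬any = [] , x , xs , refl , px , All.¬Any⇒All¬ xs ¬any
    split-last {x ∷ xs} (there any) | no ¬any = ⊥-elim (¬any any)

module _ {n : ℕ} where

  data Walk (E : Fin n → Fin n → Set) (Ok : Fin n → Set) : Fin n → Fin n → Set where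
    nil  : ∀ {x} → Ok x → Walk E Ok x x
    cons : ∀ {x y z} → Ok x → E x y → Walk E Ok y z → Walk E Ok x z

  module _ {E : Fin n → Fin n → Set} {Ok : Fin n → Set} where

    Walk-head : ∀ {x y} → Walk E Ok x y → Ok x
    Walk-head (nil o)      = o
    Walk-head (cons o _ _) = o

    _++ʷ_ : ∀ {x y z} → Walk E Ok x y → Walk E Ok y z → Walk E Ok x z
    nil _      ++ʷ w′ = w′
    cons o e w ++ʷ w′ = cons o e (w ++ʷ w′)

    Walk-map : ∀ {E′ : Fin n → Fin n → Set} {Ok′ : Fin n → Set} →
               (∀ {a b} → E a b → E′ a b) → (∀ {a} → Ok a → Ok′ a) →
               ∀ {x y} → Walk E Ok x y → Walk E′ Ok′ x y
    Walk-map f g (nil o)      = nil (g o)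
    Walk-map f g (cons o e w) = cons (g o) (f e) (Walk-map f g w)

  Separates : (E : Fin n → Fin n → Set) (X Y S : Subset n) → Set
  Separates E X Y S = ∀ {x y} → x ∈ X → y ∈ Y → ¬ Walk E (_∉ S) x y

  StartsIn : Subset n → List (Fin n) → Set
  StartsIn X []      = ⊥
  StartsIn X (x ∷ _) = x ∈ X

  EndsIn : Subset n → List (Fin n) → Set
  EndsIn Y []           = ⊥
  EndsIn Y (x ∷ [])     = x ∈ Y
  EndsIn Y (x ∷ y ∷ xs) = EndsIn Y (y ∷ xs)

  module _ {X : Subset n} where

    StartsIn⇒Any : ∀ xs → StartsIn X xs → Any (_∈ X) xs
    StartsIn⇒Any (x ∷ _) x∈X = here x∈X

    EndsIn⇒Any : ∀ xs → EndsIn X xs → Any (_∈ X) xs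
    EndsIn⇒Any (x ∷ [])     x∈X = here x∈X
    EndsIn⇒Any (x ∷ y ∷ xs) end = there (EndsIn⇒Any (y ∷ xs) end)

    StartsIn-++⁻ : ∀ xs {ys w} → w ∈ₗ xs → StartsIn X (xs ++ ys) → StartsIn X xs
    StartsIn-++⁻ (x ∷ _) _ x∈X = x∈X

    StartsIn-++ : ∀ xs {t ys ys′} → StartsIn X (xs ++ t ∷ ys) → StartsIn X (xs ++ t ∷ ys′)
    StartsIn-++ []      start = start
    StartsIn-++ (x ∷ _) start = start

    EndsIn-++⁺ : ∀ xs {t ys} → EndsIn X (t ∷ ys) → EndsIn X (xs ++ t ∷ ys)
    EndsIn-++⁺ []           end = end
    EndsIn-++⁺ (x ∷ [])     end = end
    EndsIn-++⁺ (x ∷ y ∷ xs) end = EndsIn-++⁺ (y ∷ xs) end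

    EndsIn-++⁻ : ∀ xs {t ys} → EndsIn X (xs ++ t ∷ ys) → EndsIn X (t ∷ ys)
    EndsIn-++⁻ []           end = end
    EndsIn-++⁻ (x ∷ [])     end = end
    EndsIn-++⁻ (x ∷ y ∷ xs) end = EndsIn-++⁻ (y ∷ xs) end

    EndsIn-tail : ∀ x {xs w} → w ∈ₗ xs → EndsIn X (x ∷ xs) → EndsIn X xs
    EndsIn-tail x {_ ∷ _} _ end = end

  module _ {E : Fin n → Fin n → Set} {Ok : Fin n → Set} where

    walk-prefix : ∀ x xs {w} → Linked E (x ∷ xs) → All Ok (x ∷ xs) → w ∈ₗ x ∷ xs → Walk E Ok x w
    walk-prefix x xs       _        (o ∷ _)  (here refl) = nil o
    walk-prefix x (y ∷ xs) (e ∷ es) (o ∷ os) (there w∈) = cons o e (walk-prefix y xs es os w∈)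

    walk-to-last : ∀ xs {y w} → Linked E (xs ++ y ∷ []) → All Ok (xs ++ y ∷ []) → w ∈ₗ xs → Walk E Ok w y
    walk-to-last (x ∷ [])     (e ∷ [-]) (o ∷ o′ ∷ []) (here refl) = cons o e (nil o′)
    walk-to-last (x ∷ x′ ∷ xs) (e ∷ es) (o ∷ os)      (here refl) =
      cons o e (walk-to-last (x′ ∷ xs) es os (here refl))
    walk-to-last (x ∷ xs)      es       (_ ∷ os)      (there w∈)  = walk-to-last xs (Linked.tail es) os w∈

    walk-from-start : ∀ {X} xs {w} → Linked E xs → All Ok xs → w ∈ₗ xs → StartsIn X xs →
                      ∃[ x ] (x ∈ X × Walk E Ok x w)
    walk-from-start (x ∷ xs) es os w∈ x∈X = x , x∈X , walk-prefix x xs es os w∈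

    walk-to-end : ∀ {Y} xs {w} → Linked E xs → All Ok xs → w ∈ₗ xs → EndsIn Y xs →
                  ∃[ y ] (y ∈ Y × Walk E Ok w y)
    walk-to-end (x ∷ [])     _        (o ∷ _)  (here refl) x∈Y = x , x∈Y , nil o
    walk-to-end (x ∷ y ∷ xs) (e ∷ es) (o ∷ os) (here refl) end
      with walk-to-end (y ∷ xs) es os (here refl) end
    ... | z , z∈Y , w = z , z∈Y , cons o e w
    walk-to-end (x ∷ y ∷ xs) (_ ∷ es) (_ ∷ os) (there w∈) end = walk-to-end (y ∷ xs) es os w∈ end

  record XYPath (E : Fin n → Fin n → Set) (X Y : Subset n) : Set where
    constructor xyPath
    field
      vertices : List (Fin n)
      distinct : Unique vertices
      adjacent : Linked E vertices
      starts   : StartsIn X vertices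
      ends     : EndsIn Y vertices

  open XYPath public using (vertices)

  module _ {E : Fin n → Fin n → Set} {X Y : Subset n} where

    DisjointPaths : XYPath E X Y → XYPath E X Y → Set
    DisjointPaths p q = Disjoint (vertices p) (vertices q)

  XYLinkage : (E : Fin n → Fin n → Set) (X Y : Subset n) → ℕ → Set
  XYLinkage E X Y r = Σ (List (XYPath E X Y)) λ L → AllPairs DisjointPaths L × length L ≡ r

  LinkageOrSeparator : (E : Fin n → Fin n → Set) (X Y : Subset n) → ℕ → Set
  LinkageOrSeparator E X Y r = XYLinkage E X Y r ⊎ ∃[ S ] (∣ S ∣ < r × Separates E X Y S)

  record PathInto (E : Fin n → Fin n → Set) (X T : Subset n) : Set where
    constructor pathInto
    field
      init     : List (Fin n)
      last     : Fin n
      adjacent : Linked E (init ++ last ∷ [])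
      distinct : Unique (init ++ last ∷ [])
      starts   : StartsIn X (init ++ last ∷ [])
      last∈T   : last ∈ T
      init∉T   : All (_∉ T) init

  record PathOutOf (E : Fin n → Fin n → Set) (T Y : Subset n) : Set where
    constructor pathOutOf
    field
      head     : Fin n
      tail     : List (Fin n)
      adjacent : Linked E (head ∷ tail)
      distinct : Unique (head ∷ tail)
      ends     : EndsIn Y (head ∷ tail)
      head∈T   : head ∈ T
      tail∉T   : All (_∉ T) tail

  intoVerts : ∀ {E X T} → PathInto E X T → List (Fin n)
  intoVerts p = PathInto.init p ++ PathInto.last p ∷ []

  outVerts : ∀ {E T Y} → PathOutOf E T Y → List (Fin n)
  outVerts q = PathOutOf.head q ∷ PathOutOf.tail q

  module _ {E : Fin n → Fin n → Set} where

    shorten-to-PathInto : ∀ {X T} (p : XYPath E X T) →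
                          Σ (PathInto E X T) λ p′ → intoVerts p′ ⊆ₗ vertices p
    shorten-to-PathInto {X} {T} (xyPath vs vs! es start end) =
      shorten (split-first (_∈? T) (EndsIn⇒Any vs end)) vs! es start
      where
      shorten : ∀ {vs} → FirstSplit (_∈? T) vs → Unique vs → Linked E vs → StartsIn X vs →
                Σ (PathInto E X T) λ p′ → intoVerts p′ ⊆ₗ vs
      shorten (α , t , ρ , refl , t∈T , α∉T) vs! es start =
        pathInto α t (Linked-++⁻ˡ (α ++ t ∷ []) (subst (Linked E) α·t·ρ es))
          (proj₁ (Unique-++⁻ (α ++ t ∷ []) (subst Unique α·t·ρ vs!)))
          (StartsIn-++ α start) t∈T α∉T ,
        λ x∈ → subst (_ ∈ₗ_) (sym α·t·ρ) (∈-++⁺ˡ x∈)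
        where
        α·t·ρ : α ++ t ∷ ρ ≡ (α ++ t ∷ []) ++ ρ
        α·t·ρ = sym (++-assoc α (t ∷ []) ρ)

    shorten-to-PathOutOf : ∀ {T Y} (p : XYPath E T Y) →
                           Σ (PathOutOf E T Y) λ p′ → outVerts p′ ⊆ₗ vertices p
    shorten-to-PathOutOf {T} {Y} (xyPath vs vs! es start end) =
      shorten (split-last (_∈? T) (StartsIn⇒Any vs start)) vs! es end
      where
      shorten : ∀ {vs} → LastSplit (_∈? T) vs → Unique vs → Linked E vs → EndsIn Y vs →
                Σ (PathOutOf E T Y) λ p′ → outVerts p′ ⊆ₗ vs
      shorten (ρ , t , δ , refl , t∈T , δ∉T) vs! es end =
        pathOutOf t δ (Linked-++⁻ʳ ρ es) (proj₁ (proj₂ (Unique-++⁻ ρ vs!)))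
          (EndsIn-++⁻ ρ end) t∈T δ∉T ,
        ∈-++⁺ʳ ρ

  module _ {E : Fin n → Fin n → Set} {S T : Subset n} (S⊆T : S ⊆ₛ T) where

    private
      avoid : ∀ {x} → x ∉ T → x ∉ S
      avoid x∉T = x∉T ∘ S⊆T

    PathInto-walk : ∀ {X} (p : PathInto E X T) {w} → w ∈ₗ intoVerts p → w ∉ S →
                    ∃[ x ] (x ∈ X × Walk E (_∉ S) x w)
    PathInto-walk (pathInto α t es _ start _ α∉T) w∈ w∉S with ∈-++⁻ α w∈
    ... | inj₁ w∈α =
      walk-from-start α (Linked-++⁻ˡ α es) (All.map avoid α∉T) w∈α (StartsIn-++⁻ α w∈α start)
    ... | inj₂ (here refl) =
      walk-from-start (α ++ t ∷ []) es (All.++⁺ (All.map avoid α∉T) (w∉S ∷ [])) w∈ start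

    PathOutOf-walk : ∀ {Y} (q : PathOutOf E T Y) {w} → w ∈ₗ outVerts q → w ∉ S →
                     ∃[ y ] (y ∈ Y × Walk E (_∉ S) w y)
    PathOutOf-walk (pathOutOf s δ es _ end _ δ∉T) (here refl) w∉S =
      walk-to-end (s ∷ δ) es (w∉S ∷ All.map avoid δ∉T) (here refl) end
    PathOutOf-walk (pathOutOf s δ es _ end _ δ∉T) (there w∈δ) w∉S =
      walk-to-end δ (Linked.tail es) (All.map avoid δ∉T) w∈δ (EndsIn-tail s w∈δ end)

  EdgeOf : List (Fin n × Fin n) → Fin n → Fin n → Set
  EdgeOf Es u v = (u , v) ∈ₗ Es

  Linkage-mono : ∀ {E E′ X Y r} → (∀ {a b} → E a b → E′ a b) → XYLinkage E X Y r → XYLinkage E′ X Y r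
  Linkage-mono {E} {E′} {X} {Y} E⊆E′ (L , L-disjoint , len) =
    map widen L , AllPairs.map⁺ (AllPairs.map (λ {p} {q} → widen-disjoint p q) L-disjoint) ,
    trans (length-map widen L) len
    where
    widen : XYPath E X Y → XYPath E′ X Y
    widen (xyPath vs vs! es start end) = xyPath vs vs! (Linked.map E⊆E′ es) start end
    widen-disjoint : ∀ p q → DisjointPaths p q → DisjointPaths (widen p) (widen q)
    widen-disjoint (xyPath _ _ _ _ _) (xyPath _ _ _ _ _) p#q = p#q

  singleton-linkage : ∀ {E X Y} zs → Unique zs → All (_∈ X ∩ Y) zs →
    Σ (List (XYPath E X Y)) λ L → AllPairs DisjointPaths L × length L ≡ length zs ×
                                   All (λ p → vertices p ⊆ₗ zs) L
  singleton-linkage [] _ _ = [] , [] , refl , []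
  singleton-linkage {E} {X} {Y} (z ∷ zs) (z∉zs ∷ zs!) (z∈X∩Y ∷ zs∈) with singleton-linkage zs zs! zs∈
  ... | L , L-disjoint , len , L⊆zs =
    z-path ∷ L , All.tabulate z#L ∷ L-disjoint , cong suc len ,
    (λ { (here refl) → here refl }) ∷ All.map (λ p⊆zs {x} x∈p → there (p⊆zs x∈p)) L⊆zs
    where
    z-path : XYPath E X Y
    z-path = xyPath (z ∷ []) ([] ∷ []) [-] (proj₁ (x∈p∩q⁻ X Y z∈X∩Y)) (proj₂ (x∈p∩q⁻ X Y z∈X∩Y))
    z#L : ∀ {p} → p ∈ₗ L → DisjointPaths z-path p
    z#L p∈L (here refl , z∈p) = All.lookup z∉zs (All.lookup L⊆zs p∈L z∈p) refl

  menger-edgeless : ∀ X Y r → LinkageOrSeparator (EdgeOf []) X Y r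
  menger-edgeless X Y r with r ≤? length (elements (X ∩ Y))
  ... | yes r≤ =
    let zs = elements (X ∩ Y)
        L , L-disjoint , len , _ =
          singleton-linkage (take r zs) (Unique.take⁺ r (elements-unique (X ∩ Y)))
            (All.take⁺ r (elements⊆ (X ∩ Y)))
    in inj₁ (L , L-disjoint , trans len (trans (length-take r zs) (m≤n⇒m⊓n≡m r≤)))
  ... | no r≰ = inj₂ (X ∩ Y , ≤-<-trans (∣p∣≤length (X ∩ Y) _ (∈-elements⁺ (X ∩ Y))) (≰⇒> r≰) , X∩Y-separates)
    where
    X∩Y-separates : Separates (EdgeOf []) X Y (X ∩ Y)
    X∩Y-separates x∈X y∈Y (nil x∉X∩Y) = x∉X∩Y (x∈p∩q⁺ (x∈X , y∈Y))

  module _ (Es : List (Fin n × Fin n)) (u v : Fin n) where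

    private
      E₀ E⁺ : Fin n → Fin n → Set
      E₀ = EdgeOf Es
      E⁺ = EdgeOf ((u , v) ∷ Es)

    separates-if-endpoint∈ : ∀ {X Y S} → u ∈ S ⊎ v ∈ S → Separates E₀ X Y S → Separates E⁺ X Y S
    separates-if-endpoint∈ {S = S} u∨v∈S sep x∈X y∈Y W = sep x∈X y∈Y (avoid-uv W)
      where
      avoid-uv : ∀ {a b} → Walk E⁺ (_∉ S) a b → Walk E₀ (_∉ S) a b
      avoid-uv (nil a∉S) = nil a∉S
      avoid-uv (cons a∉S (there e) W) = cons a∉S e (avoid-uv W)
      avoid-uv (cons u∉S (here refl) W) = ⊥-elim ([ u∉S , Walk-head W ]′ u∨v∈S)

    -- before its first visit to T ∋ u, a walk cannot use the new edge uv
    walk-until : ∀ {S T} → u ∈ T → ∀ {x y} → Walk E⁺ (_∉ S) x y →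
                 (∃[ t ] (t ∈ T × Walk E₀ (_∉ S) x t)) ⊎ Walk E₀ (_∉ T) x y
    walk-until {T = T} u∈T {x} W with x ∈? T
    ... | yes x∈T = inj₁ (x , x∈T , nil (Walk-head W))
    walk-until u∈T (nil _)                | no x∉T = inj₂ (nil x∉T)
    walk-until u∈T (cons _ (here refl) _) | no u∉T = ⊥-elim (u∉T u∈T)
    walk-until u∈T (cons o (there e) W)   | no x∉T with walk-until u∈T W
    ... | inj₁ (t , t∈T , W′) = inj₁ (t , t∈T , cons o e W′)
    ... | inj₂ W′             = inj₂ (cons x∉T e W′)

    -- after its last visit to T ∋ v, a walk cannot use the new edge uv
    walk-after : ∀ {S T} → v ∈ T → ∀ {x y} → Walk E⁺ (_∉ S) x y →
                 (∃[ t ] (t ∈ T × Walk E₀ (_∉ S) t y)) ⊎ Walk E₀ (λ z → z ∉ T × z ∉ S) x y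
    walk-after {T = T} v∈T {x} (nil x∉S) with x ∈? T
    ... | yes x∈T = inj₁ (x , x∈T , nil x∉S)
    ... | no  x∉T = inj₂ (nil (x∉T , x∉S))
    walk-after {T = T} v∈T {x} (cons x∉S e W) with walk-after v∈T W
    ... | inj₁ tail = inj₁ tail
    ... | inj₂ W′ with e | x ∈? T
    ...   | here refl | _       = ⊥-elim (proj₁ (Walk-head W′) v∈T)
    ...   | there e′  | yes x∈T = inj₁ (x , x∈T , cons x∉S e′ (Walk-map id proj₂ W′))
    ...   | there e′  | no  x∉T = inj₂ (cons (x∉T , x∉S) e′ W′)

    separates-before : ∀ {X Y S S′ T} → S ⊆ₛ T → u ∈ T →
                       Separates E₀ X Y S → Separates E₀ X T S′ → Separates E⁺ X Y S′
    separates-before S⊆T u∈T sep sep′ x∈X y∈Y W with walk-until u∈T W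
    ... | inj₁ (t , t∈T , W′) = sep′ x∈X t∈T W′
    ... | inj₂ W′             = sep x∈X y∈Y (Walk-map id (λ z∉T → z∉T ∘ S⊆T) W′)

    separates-after : ∀ {X Y S S′ T} → S ⊆ₛ T → v ∈ T →
                      Separates E₀ X Y S → Separates E₀ T Y S′ → Separates E⁺ X Y S′
    separates-after S⊆T v∈T sep sep′ x∈X y∈Y W with walk-after v∈T W
    ... | inj₁ (t , t∈T , W′) = sep′ t∈T y∈Y W′
    ... | inj₂ W′             = sep x∈X y∈Y (Walk-map id (λ (z∉T , _) → z∉T ∘ S⊆T) W′)

  -- A vertex shared by an X–(S ∪ {u}) path and an (S ∪ {v})–Y path lies in S (else S would not
  -- separate), so it is the last vertex of the first and the first vertex of the second. Hence a
  -- prefix ending in s ∈ S can be continued by the suffix starting at s, and the prefix ending in u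
  -- by uv and the suffix starting at v; L₂ has a suffix starting at every vertex of S ∪ {v}.
  module Augment (Es : List (Fin n × Fin n)) {u v : Fin n} {X Y S : Subset n}
    (sep : Separates (EdgeOf Es) X Y S) (u∉S : u ∉ S) (v∉S : v ∉ S)
    (L₂ : List (PathOutOf (EdgeOf Es) (S ∪ ⁅ v ⁆) Y))
    (L₂-disjoint : AllPairs (λ q q′ → Disjoint (outVerts q) (outVerts q′)) L₂)
    (L₂-large : ∣ S ∪ ⁅ v ⁆ ∣ ≤ length L₂)
    where

    E₀ E⁺ : Fin n → Fin n → Set
    E₀ = EdgeOf Es
    E⁺ = EdgeOf ((u , v) ∷ Es)

    Into OutOf : Set
    Into = PathInto E₀ X (S ∪ ⁅ u ⁆)
    OutOf = PathOutOf E₀ (S ∪ ⁅ v ⁆) Y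

    open PathInto using (init; last; last∈T; init∉T)
    open PathOutOf using (head; tail∉T; head∈T)

    shared∈S : (p : Into) (q : OutOf) → ∀ {w} → w ∈ₗ intoVerts p → w ∈ₗ outVerts q → w ∈ S
    shared∈S p q {w} w∈p w∈q with w ∈? S
    ... | yes w∈S = w∈S
    ... | no  w∉S with PathInto-walk (p⊆p∪q ⁅ u ⁆) p w∈p w∉S | PathOutOf-walk (p⊆p∪q ⁅ v ⁆) q w∈q w∉S
    ...   | x , x∈X , W | y , y∈Y , W′ = ⊥-elim (sep x∈X y∈Y (W ++ʷ W′))

    init#out : (p : Into) (q : OutOf) → Disjoint (init p) (outVerts q)
    init#out p q (w∈α , w∈q) =
      All.lookup (init∉T p) w∈α (p⊆p∪q ⁅ u ⁆ (shared∈S p q (∈-++⁺ˡ w∈α) w∈q))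

    last∈verts : (p : Into) → last p ∈ₗ intoVerts p
    last∈verts p = ∈-++⁺ʳ (init p) (here refl)

    last∉init : (p : Into) → last p ∉ₗ init p
    last∉init p l∈α = proj₂ (proj₂ (Unique-++⁻ (init p) (PathInto.distinct p))) (l∈α , here refl)

    S∩into⇒last : (p : Into) → ∀ {w} → w ∈ₗ intoVerts p → w ∈ S → w ≡ last p
    S∩into⇒last p w∈p w∈S with ∈-++⁻ (init p) w∈p
    ... | inj₁ w∈α         = ⊥-elim (All.lookup (init∉T p) w∈α (p⊆p∪q ⁅ u ⁆ w∈S))
    ... | inj₂ (here refl) = refl

    S∩out⇒head : (q : OutOf) → ∀ {w} → w ∈ₗ outVerts q → w ∈ S → w ≡ head q
    S∩out⇒head q (here refl) _   = refl
    S∩out⇒head q (there w∈δ) w∈S = ⊥-elim (All.lookup (tail∉T q) w∈δ (p⊆p∪q ⁅ v ⁆ w∈S))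

    Match : Into → OutOf → Set
    Match p q = (last p ∈ S × head q ≡ last p) ⊎ (last p ≡ u × head q ≡ v)

    Match-injective : ∀ {p₁ p₂ q} → Match p₁ q → Match p₂ q → last p₁ ≡ last p₂
    Match-injective (inj₁ (_ , e₁))   (inj₁ (_ , e₂))   = trans (sym e₁) e₂
    Match-injective (inj₁ (l∈S , e₁)) (inj₂ (_ , e₂))   = ⊥-elim (v∉S (subst (_∈ S) (trans (sym e₁) e₂) l∈S))
    Match-injective (inj₂ (_ , e₁))   (inj₁ (l∈S , e₂)) = ⊥-elim (v∉S (subst (_∈ S) (trans (sym e₂) e₁) l∈S))
    Match-injective (inj₂ (e₁ , _))   (inj₂ (e₂ , _))   = trans e₁ (sym e₂)

    suffix-from : ∀ z → z ∈ S ∪ ⁅ v ⁆ → Σ OutOf λ q → q ∈ₗ L₂ × head q ≡ z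
    suffix-from z z∈ with ∈-map⁻ head (Unique∧∣p∣≤length⇒p⊆ (S ∪ ⁅ v ⁆) heads! heads∈ heads-large z∈)
      where
      heads! : Unique (map head L₂)
      heads! = AllPairs.map⁺ (AllPairs.map (λ q#q′ e → q#q′ (here refl , here e)) L₂-disjoint)
      heads∈ : All (_∈ S ∪ ⁅ v ⁆) (map head L₂)
      heads∈ = All.map⁺ (All.tabulate (λ {q} _ → head∈T q))
      heads-large : ∣ S ∪ ⁅ v ⁆ ∣ ≤ length (map head L₂)
      heads-large = ≤-trans L₂-large (≤-reflexive (sym (length-map head L₂)))
    ... | q , q∈ , refl = q , q∈ , refl

    partner : (p : Into) → Σ OutOf λ q → q ∈ₗ L₂ × Match p q
    partner p with last p ∈? S
    ... | yes l∈S = let q , q∈ , e = suffix-from (last p) (p⊆p∪q ⁅ v ⁆ l∈S) in q , q∈ , inj₁ (l∈S , e)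
    ... | no  l∉S with x∈p∪q⁻ S ⁅ u ⁆ (last∈T p)
    ...   | inj₁ l∈S  = ⊥-elim (l∉S l∈S)
    ...   | inj₂ l∈⁅u⁆ = let q , q∈ , e = suffix-from v (q⊆p∪q S ⁅ v ⁆ (x∈⁅x⁆ v))
                         in q , q∈ , inj₂ (x∈⁅y⁆⇒x≡y u l∈⁅u⁆ , e)

    join : (p : Into) (q : OutOf) → Match p q → XYPath E⁺ X Y
    join p@(pathInto α t es α·t! start _ _) q@(pathOutOf .t δ es′ t·δ! end _ _) (inj₁ (_ , refl)) =
      xyPath (α ++ t ∷ δ)
        (Unique.++⁺ (proj₁ (Unique-++⁻ α α·t!)) t·δ! (init#out p q))
        (Linked-join α (Linked.map there es) (Linked.map there es′))
        (StartsIn-++ α start) (EndsIn-++⁺ α end)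
    join p@(pathInto α .u es α·u! start _ _) q@(pathOutOf .v δ es′ v·δ! end _ _) (inj₂ (refl , refl)) =
      xyPath (α ++ u ∷ v ∷ δ)
        (Unique.++⁺ (proj₁ (Unique-++⁻ α α·u!)) (u∉q ∷ v·δ!) α#u·q)
        (Linked-join α (Linked.map there es) (here refl ∷ Linked.map there es′))
        (StartsIn-++ α start) (EndsIn-++⁺ α end)
      where
      -- u lies on p, so if it lay on q it would lie in S
      u∉q : All (u ≢_) (v ∷ δ)
      u∉q = All.tabulate λ { w∈q refl → u∉S (shared∈S p q (last∈verts p) w∈q) }
      α#u·q : Disjoint α (u ∷ v ∷ δ)
      α#u·q (w∈α , here refl) = last∉init p w∈α
      α#u·q (w∈α , there w∈q) = init#out p q (w∈α , w∈q)

    join-⊆ : ∀ p q (m : Match p q) {x} → x ∈ₗ vertices (join p q m) → x ∈ₗ intoVerts p ⊎ x ∈ₗ outVerts q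
    join-⊆ (pathInto α _ _ _ _ _ _) (pathOutOf _ _ _ _ _ _ _) (inj₁ (_ , refl)) x∈ with ∈-++⁻ α x∈
    ... | inj₁ x∈α = inj₁ (∈-++⁺ˡ x∈α)
    ... | inj₂ x∈q = inj₂ x∈q
    join-⊆ (pathInto α _ _ _ _ _ _) (pathOutOf _ _ _ _ _ _ _) (inj₂ (refl , refl)) x∈ with ∈-++⁻ α x∈
    ... | inj₁ x∈α          = inj₁ (∈-++⁺ˡ x∈α)
    ... | inj₂ (here refl)  = inj₁ (∈-++⁺ʳ α (here refl))
    ... | inj₂ (there x∈q)  = inj₂ x∈q

    into#out : ∀ p₁ {p₂ q₂} → Match p₂ q₂ → Disjoint (intoVerts p₁) (intoVerts p₂) →
               Disjoint (intoVerts p₁) (outVerts q₂)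
    into#out p₁ {p₂} {q₂} m₂ p₁#p₂ {x} (x∈p₁ , x∈q₂)
      with shared∈S p₁ q₂ x∈p₁ x∈q₂
    ... | x∈S with S∩into⇒last p₁ x∈p₁ x∈S | S∩out⇒head q₂ x∈q₂ x∈S | m₂
    ...   | refl | refl | inj₁ (_ , e) = p₁#p₂ (x∈p₁ , subst (_∈ₗ intoVerts p₂) (sym e) (last∈verts p₂))
    ...   | refl | refl | inj₂ (_ , e) = v∉S (subst (_∈ S) e x∈S)

    join-disjoint : ∀ {p₁ p₂ q₁ q₂} → q₁ ∈ₗ L₂ → q₂ ∈ₗ L₂ → (m₁ : Match p₁ q₁) (m₂ : Match p₂ q₂) →
                    Disjoint (intoVerts p₁) (intoVerts p₂) → DisjointPaths (join p₁ q₁ m₁) (join p₂ q₂ m₂)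
    join-disjoint {p₁} {p₂} {q₁} {q₂} q₁∈ q₂∈ m₁ m₂ p₁#p₂ {x} (x∈₁ , x∈₂)
      with join-⊆ p₁ q₁ m₁ x∈₁ | join-⊆ p₂ q₂ m₂ x∈₂
    ... | inj₁ x∈p₁ | inj₁ x∈p₂ = p₁#p₂ (x∈p₁ , x∈p₂)
    ... | inj₁ x∈p₁ | inj₂ x∈q₂ = into#out p₁ {p₂} {q₂} m₂ p₁#p₂ (x∈p₁ , x∈q₂)
    ... | inj₂ x∈q₁ | inj₁ x∈p₂ = into#out p₂ {p₁} {q₁} m₁ (λ (a , b) → p₁#p₂ (b , a)) (x∈p₂ , x∈q₁)
    ... | inj₂ x∈q₁ | inj₂ x∈q₂ with AllPairs-lookup₂ L₂-disjoint q₁∈ q₂∈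
    ...   | inj₁ refl         =
      p₁#p₂ (last∈verts p₁ , subst (_∈ₗ intoVerts p₂) (sym (Match-injective {p₁} {p₂} {q₁} m₁ m₂))
                                   (last∈verts p₂))
    ...   | inj₂ (inj₁ q₁#q₂) = q₁#q₂ {x} (x∈q₁ , x∈q₂)
    ...   | inj₂ (inj₂ q₂#q₁) = q₂#q₁ {x} (x∈q₂ , x∈q₁)

    extend : Into → XYPath E⁺ X Y
    extend p = let q , _ , m = partner p in join p q m

    extend-disjoint : ∀ p₁ p₂ → Disjoint (intoVerts p₁) (intoVerts p₂) → DisjointPaths (extend p₁) (extend p₂)
    extend-disjoint p₁ p₂ = let _ , q₁∈ , m₁ = partner p₁ ; _ , q₂∈ , m₂ = partner p₂ in
      join-disjoint q₁∈ q₂∈ m₁ m₂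

    augment : (L₁ : List Into) → AllPairs (λ p p′ → Disjoint (intoVerts p) (intoVerts p′)) L₁ →
              XYLinkage E⁺ X Y (length L₁)
    augment L₁ L₁-disjoint =
      map extend L₁ , AllPairs.map⁺ (AllPairs.map (λ {p₁} {p₂} → extend-disjoint p₁ p₂) L₁-disjoint) ,
      length-map extend L₁

  menger-step : ∀ Es {u v X Y S r} → Separates (EdgeOf Es) X Y S → ∣ S ∣ < r →
                LinkageOrSeparator (EdgeOf Es) X (S ∪ ⁅ u ⁆) r →
                LinkageOrSeparator (EdgeOf Es) (S ∪ ⁅ v ⁆) Y r →
                LinkageOrSeparator (EdgeOf ((u , v) ∷ Es)) X Y r
  menger-step Es {u} {v} {S = S} sep _ (inj₂ (S′ , ∣S′∣<r , sep′)) _ =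
    inj₂ (S′ , ∣S′∣<r , separates-before Es u v (p⊆p∪q ⁅ u ⁆) (q⊆p∪q S ⁅ u ⁆ (x∈⁅x⁆ u)) sep sep′)
  menger-step Es {u} {v} {S = S} sep _ (inj₁ _) (inj₂ (S′ , ∣S′∣<r , sep′)) =
    inj₂ (S′ , ∣S′∣<r , separates-after Es u v (p⊆p∪q ⁅ v ⁆) (q⊆p∪q S ⁅ v ⁆ (x∈⁅x⁆ v)) sep sep′)
  menger-step Es {u} {v} {X} {Y} {S} {r} sep ∣S∣<r
    (inj₁ (L₁ , L₁-disjoint , len₁)) (inj₁ (L₂ , L₂-disjoint , len₂))
    with u ∈? S | v ∈? S
  ... | yes u∈S | _       = inj₂ (S , ∣S∣<r , separates-if-endpoint∈ Es u v (inj₁ u∈S) sep)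
  ... | no _    | yes v∈S = inj₂ (S , ∣S∣<r , separates-if-endpoint∈ Es u v (inj₂ v∈S) sep)
  ... | no u∉S  | no v∉S  =
    let L , L-disjoint , len = Augment.augment Es sep u∉S v∉S suffixes suffixes-disjoint suffixes-large
                                 prefixes prefixes-disjoint
    in inj₁ (L , L-disjoint , trans len (trans (length-map _ L₁) len₁))
    where
    prefixes : List (PathInto (EdgeOf Es) X (S ∪ ⁅ u ⁆))
    prefixes = map (proj₁ ∘ shorten-to-PathInto) L₁

    suffixes : List (PathOutOf (EdgeOf Es) (S ∪ ⁅ v ⁆) Y)
    suffixes = map (proj₁ ∘ shorten-to-PathOutOf) L₂

    prefixes-disjoint : AllPairs (λ p q → Disjoint (intoVerts p) (intoVerts q)) prefixes
    prefixes-disjoint = AllPairs.map⁺ (AllPairs.map (λ {p} {q} p#q {x} (x∈p , x∈q) →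
      p#q (proj₂ (shorten-to-PathInto p) x∈p , proj₂ (shorten-to-PathInto q) x∈q)) L₁-disjoint)

    suffixes-disjoint : AllPairs (λ p q → Disjoint (outVerts p) (outVerts q)) suffixes
    suffixes-disjoint = AllPairs.map⁺ (AllPairs.map (λ {p} {q} p#q {x} (x∈p , x∈q) →
      p#q (proj₂ (shorten-to-PathOutOf p) x∈p , proj₂ (shorten-to-PathOutOf q) x∈q)) L₂-disjoint)

    suffixes-large : ∣ S ∪ ⁅ v ⁆ ∣ ≤ length suffixes
    suffixes-large = begin
      ∣ S ∪ ⁅ v ⁆ ∣      ≤⟨ ∣p∪⁅x⁆∣≤1+∣p∣ S v ⟩
      suc ∣ S ∣          ≤⟨ ∣S∣<r ⟩
      r                  ≡⟨ sym len₂ ⟩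
      length L₂          ≡⟨ sym (length-map _ L₂) ⟩
      length suffixes    ∎
      where open ≤-Reasoning

  menger : (Es : List (Fin n × Fin n)) (X Y : Subset n) (r : ℕ) → LinkageOrSeparator (EdgeOf Es) X Y r
  menger [] X Y r = menger-edgeless X Y r
  menger ((u , v) ∷ Es) X Y r with menger Es X Y r
  ... | inj₁ L                 = inj₁ (Linkage-mono there L)
  ... | inj₂ (S , ∣S∣<r , sep) =
    menger-step Es sep ∣S∣<r (menger Es X (S ∪ ⁅ u ⁆) r) (menger Es (S ∪ ⁅ v ⁆) Y r)

Piece : ℕ → Set
Piece n = Fin n × List (Fin n)

module _ {n : ℕ} where

  pieceVerts : Piece n → List (Fin n)
  pieceVerts (a , T) = a ∷ T

  flatten : List (Piece n) → List (Fin n)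
  flatten []             = []
  flatten ((a , T) ∷ ps) = a ∷ T ++ flatten ps

  _#ᵖ_ : Piece n → Piece n → Set
  p #ᵖ q = Disjoint (pieceVerts p) (pieceVerts q)

  #ᵖ-flatten : ∀ {p} ps → All (p #ᵖ_) ps → Disjoint (pieceVerts p) (flatten ps)
  #ᵖ-flatten ((a , T) ∷ ps) (p#q ∷ p#ps) (x∈p , x∈q·ps) with ∈-++⁻ (a ∷ T) x∈q·ps
  ... | inj₁ x∈q  = p#q (x∈p , x∈q)
  ... | inj₂ x∈ps = #ᵖ-flatten ps p#ps (x∈p , x∈ps)

  ¬avoids⇒meets : ∀ (S : Subset n) xs → ¬ All (_∉ S) xs → ∃[ w ] (w ∈ₗ xs × w ∈ S)
  ¬avoids⇒meets S xs ¬all =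
    let w , w∈xs , ¬w∉S = find (All.¬All⇒Any¬ (λ x → ¬? (x ∈? S)) xs ¬all)
    in w , w∈xs , decidable-stable (w ∈? S) ¬w∉S

  module _ (X S : Subset n) where

    Clear : Piece n → Set
    Clear (a , T) = a ∈ X × All (_∉ S) (a ∷ T)

    -- Each non-clear piece with head in X contributes its head and a vertex of S on it;
    -- the latter are distinct as the pieces are disjoint, so there are at most ∣ S ∣ of them.
    private
      Hits : List (Piece n) → Set
      Hits ps = Σ (List (Fin n × Fin n)) λ hs →
        (∀ {x} → x ∈ X → x ∈ₗ map proj₁ ps → x ∈ₗ map proj₁ hs) ×
        Unique (map proj₂ hs) × All (_∈ S) (map proj₂ hs) × All (_∈ₗ flatten ps) (map proj₂ hs)

      hits : (ps : List (Piece n)) → All (¬_ ∘ Clear) ps → AllPairs _#ᵖ_ ps → Hits ps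
      hits [] _ _ = [] , (λ _ ()) , [] , [] , []
      hits ((a , T) ∷ ps) (bad ∷ bads) (a·T#ps ∷ ps#) with hits ps bads ps# | a ∈? X
      ... | hs , X⊆hs , hs! , hs⊆S , hs⊆ps | no a∉X =
        hs , X⊆hs′ , hs! , hs⊆S , All.map (∈-++⁺ʳ (a ∷ T)) hs⊆ps
        where
        X⊆hs′ : ∀ {x} → x ∈ X → x ∈ₗ a ∷ map proj₁ ps → x ∈ₗ map proj₁ hs
        X⊆hs′ x∈X (here refl) = ⊥-elim (a∉X x∈X)
        X⊆hs′ x∈X (there x∈)  = X⊆hs x∈X x∈
      ... | hs , X⊆hs , hs! , hs⊆S , hs⊆ps | yes a∈X
        with ¬avoids⇒meets S (a ∷ T) (bad ∘ (a∈X ,_))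
      ...   | w , w∈a·T , w∈S =
        (a , w) ∷ hs , X⊆hs′ , w∉hs ∷ hs! , w∈S ∷ hs⊆S , ∈-++⁺ˡ w∈a·T ∷ All.map (∈-++⁺ʳ (a ∷ T)) hs⊆ps
        where
        X⊆hs′ : ∀ {x} → x ∈ X → x ∈ₗ a ∷ map proj₁ ps → x ∈ₗ a ∷ map proj₁ hs
        X⊆hs′ _   (here refl) = here refl
        X⊆hs′ x∈X (there x∈)  = there (X⊆hs x∈X x∈)
        w∉hs : All (w ≢_) (map proj₂ hs)
        w∉hs = All.tabulate λ { h∈ refl → #ᵖ-flatten ps a·T#ps (w∈a·T , All.lookup hs⊆ps h∈) }

    clear-piece : (ps : List (Piece n)) → AllPairs _#ᵖ_ ps → (∀ {x} → x ∈ X → x ∈ₗ map proj₁ ps) →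
                     ∣ S ∣ < ∣ X ∣ → ∃[ p ] (p ∈ₗ ps × Clear p)
    clear-piece ps ps# X⊆heads ∣S∣<∣X∣ with Any.any? clear? ps
      where
      clear? : ∀ p → Dec (Clear p)
      clear? (a , T) = (a ∈? X) ×-dec All.all? (λ x → ¬? (x ∈? S)) (a ∷ T)
    ... | yes any = find any
    ... | no none with hits ps (All.¬Any⇒All¬ ps none) ps#
    ...   | hs , X⊆hs , hs! , hs⊆S , _ = ⊥-elim (<⇒≱ ∣S∣<∣X∣ (begin
      ∣ X ∣                    ≤⟨ ∣p∣≤length X (map proj₁ hs) (λ x∈X → X⊆hs x∈X (X⊆heads x∈X)) ⟩
      length (map proj₁ hs)    ≡⟨ length-map proj₁ hs ⟩
      length hs                ≡⟨ length-map proj₂ hs ⟨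
      length (map proj₂ hs)    ≤⟨ Unique⇒length≤∣p∣ S hs! hs⊆S ⟩
      ∣ S ∣                    ∎))
      where open ≤-Reasoning

  pieces-disjoint : ∀ ps → Unique (flatten ps) → AllPairs _#ᵖ_ ps
  pieces-disjoint []             _ = []
  pieces-disjoint ((a , T) ∷ ps) a·T·ps! with Unique-++⁻ (a ∷ T) a·T·ps!
  ... | _ , ps! , a·T#ps = All.tabulate (λ q∈ps (x∈p , x∈q) → a·T#ps (x∈p , flatten-⊇ ps q∈ps x∈q))
                           ∷ pieces-disjoint ps ps!
    where
    flatten-⊇ : ∀ ps {q x} → q ∈ₗ ps → x ∈ₗ pieceVerts q → x ∈ₗ flatten ps
    flatten-⊇ ((b , U) ∷ ps) (here refl) x∈q = ∈-++⁺ˡ {xs = b ∷ U} x∈q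
    flatten-⊇ ((b , U) ∷ ps) (there q∈) x∈q  = ∈-++⁺ʳ (b ∷ U) (flatten-⊇ ps q∈ x∈q)

  pieces-linked : ∀ {R : Fin n → Fin n → Set} ps → Linked R (flatten ps) → All (Linked R ∘ pieceVerts) ps
  pieces-linked []             _  = []
  pieces-linked ((a , T) ∷ ps) rs = Linked-++⁻ˡ (a ∷ T) rs ∷ pieces-linked ps (Linked-++⁻ʳ (a ∷ T) rs)

  -- pairs each head aᵢ with the segment preceding it on the path T₀ a₁ T₁ a₂ T₂ …
  backward : List (Fin n) → List (Piece n) → List (Piece n)
  backward T₀ []             = []
  backward T₀ ((a , T) ∷ ps) = (a , T₀) ∷ backward T ps

  heads-backward : ∀ T₀ ps → map proj₁ (backward T₀ ps) ≡ map proj₁ ps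
  heads-backward T₀ []             = refl
  heads-backward T₀ ((a , T) ∷ ps) = cong (a ∷_) (heads-backward T ps)

  backward-All : ∀ {P : List (Fin n) → Set} {T₀} ps → P T₀ → All (P ∘ proj₂) ps →
                 All (P ∘ proj₂) (backward T₀ ps)
  backward-All []             _    _          = []
  backward-All ((a , T) ∷ ps) P-T₀ (P-T ∷ Ps) = P-T₀ ∷ backward-All ps P-T Ps

  backward-disjoint : ∀ T₀ ps → Unique (T₀ ++ flatten ps) → AllPairs _#ᵖ_ (backward T₀ ps)
  backward-disjoint T₀ []             _ = []
  backward-disjoint T₀ ((a , T) ∷ ps) T₀·a·T·ps! with Unique-++⁻ T₀ T₀·a·T·ps!
  ... | _ , a∉T·ps ∷ T·ps! , T₀#a·T·ps =
    All.tabulate (λ q∈ (x∈p , x∈q) → a·T₀#T·ps (x∈p , backward-⊆ T ps q∈ x∈q)) ∷ backward-disjoint T ps T·ps!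
    where
    backward-⊆ : ∀ T ps {q x} → q ∈ₗ backward T ps → x ∈ₗ pieceVerts q → x ∈ₗ T ++ flatten ps
    backward-⊆ T ((b , U) ∷ ps) (here refl) (here refl) = ∈-++⁺ʳ T (here refl)
    backward-⊆ T ((b , U) ∷ ps) (here refl) (there x∈T) = ∈-++⁺ˡ x∈T
    backward-⊆ T ((b , U) ∷ ps) (there q∈)  x∈q         = ∈-++⁺ʳ T (there (backward-⊆ U ps q∈ x∈q))
    a·T₀#T·ps : Disjoint (a ∷ T₀) (T ++ flatten ps)
    a·T₀#T·ps (here refl , x∈) = All.lookup a∉T·ps x∈ refl
    a·T₀#T·ps (there x∈T₀ , x∈) = T₀#a·T·ps (x∈T₀ , there x∈)

  backward-linked : ∀ {R : Fin n → Fin n → Set} T₀ ps → Linked R (T₀ ++ flatten ps) →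
                    All (λ (a , T) → Linked R (T ++ a ∷ [])) (backward T₀ ps)
  backward-linked T₀ []             _  = []
  backward-linked T₀ ((a , T) ∷ ps) rs =
    Linked-++⁻ˡ (T₀ ++ a ∷ []) (subst (Linked _) (sym (++-assoc T₀ (a ∷ []) (T ++ flatten ps))) rs) ∷
    backward-linked T ps (Linked.tail (Linked-++⁻ʳ T₀ rs))

module _ {n : ℕ} (G : Digraph n) where

  private
    adjacent? : Decidable (λ (e : Fin n × Fin n) → Edge G (proj₁ e) (proj₂ e))
    adjacent? (u , v) = adj G u v Bool.≟ true

    allPairs : List (Fin n × Fin n)
    allPairs = cartesianProduct (allFin n) (allFin n)

  edges : List (Fin n × Fin n)
  edges = filter adjacent? allPairs

  edges-sound : ∀ {u v} → EdgeOf edges u v → Edge G u v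
  edges-sound uv∈ = proj₂ (∈-filter⁻ adjacent? {xs = allPairs} uv∈)

  edges-complete : ∀ {u v} → Edge G u v → EdgeOf edges u v
  edges-complete {u} {v} = ∈-filter⁺ adjacent? (∈-cartesianProduct⁺ (∈-allFin u) (∈-allFin v))

  EndsIn⇒lastOf∈ : ∀ {Y} x xs → EndsIn Y (x ∷ xs) → lastOf G x xs ∈ Y
  EndsIn⇒lastOf∈ x []       x∈Y = x∈Y
  EndsIn⇒lastOf∈ x (y ∷ xs) end = EndsIn⇒lastOf∈ y xs end

  toPath : ∀ {X Y} → XYPath (EdgeOf edges) X Y → Path G
  toPath (xyPath (x ∷ xs) vs! es _ _) =
    record { first = x ; rest = xs ; unique = vs! ; linked = Linked.map edges-sound es }

  toPath-verts : ∀ {X Y} (p : XYPath (EdgeOf edges) X Y) → verts G (toPath p) ≡ vertices p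
  toPath-verts (xyPath (_ ∷ _) _ _ _ _) = refl

  toPath-ends : ∀ {X Y} (p : XYPath (EdgeOf edges) X Y) → first (toPath p) ∈ X × final G (toPath p) ∈ Y
  toPath-ends (xyPath (x ∷ xs) _ _ start end) = start , EndsIn⇒lastOf∈ x xs end

  toLinkage : ∀ {X Y r} → XYLinkage (EdgeOf edges) X Y r → ∃[ L ] (IsLinkage G X Y L × length L ≡ r)
  toLinkage (L , L-disjoint , len) =
    map toPath L ,
    (AllPairs.map⁺ (AllPairs.map (λ {p} {q} p#q x x∈p x∈q → p#q (in-p p x∈p , in-p q x∈q)) L-disjoint) ,
     All.map⁺ (All.tabulate (λ {p} _ → toPath-ends p))) ,
    trans (length-map toPath L) len
    where
    in-p : ∀ p {x} → x ∈ₗ verts G (toPath p) → x ∈ₗ vertices p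
    in-p p = subst (_ ∈ₗ_) (toPath-verts p)

  Reach⇒Walk : ∀ {S H u v} → (∀ {x} → x ∈ V H → x ∉ S) → u ∈ V H → Reach G H u v → Walk (Edge G) (_∉ S) u v
  Reach⇒Walk H∩S=∅ u∈H Reach.here = nil (H∩S=∅ u∈H)
  Reach⇒Walk {H = H} H∩S=∅ u∈H (step e r) =
    let uw , _ , w∈H = E⊆ H _ _ e in cons (H∩S=∅ u∈H) uw (Reach⇒Walk H∩S=∅ w∈H r)

module Bramble {n : ℕ} (G : Digraph n) (𝓑 : List (Subgraph G)) where

  Meets : Subgraph G → Subset n → Set
  Meets B C = ∃[ x ] (x ∈ C × x ∈ V B)

  Covers : Subset n → List (Fin n) → Set
  Covers C Q = All (λ B → Any (_∈ V B) Q → Meets B C) 𝓑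

  -- Heavy j Q: the elements of 𝓑 that meet Q form a sub-bramble of order at least j.
  Light Heavy : ℕ → List (Fin n) → Set
  Light j Q = ∃[ C ] (∣ C ∣ < j × Covers C Q)
  Heavy j Q = ∀ C → ∣ C ∣ < j → ¬ Covers C Q

  meets? : ∀ B C → Dec (Meets B C)
  meets? B C = Fin.any? (λ x → (x ∈? C) ×-dec (x ∈? V B))

  covers? : ∀ C Q → Dec (Covers C Q)
  covers? C Q = All.all? (λ B → Any.any? (_∈? V B) Q →-dec meets? B C) 𝓑

  light? : ∀ j Q → Dec (Light j Q)
  light? j Q = anySubset? (λ C → (suc ∣ C ∣ ≤? j) ×-dec covers? C Q)

  uncovered : ∀ {C Q} → ¬ Covers C Q → ∃[ B ] (B ∈ₗ 𝓑 × Any (_∈ V B) Q × ¬ Meets B C)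
  uncovered {C} {Q} ¬covers
    with find (All.¬All⇒Any¬ (λ B → Any.any? (_∈? V B) Q →-dec meets? B C) 𝓑 ¬covers)
  ... | B , B∈𝓑 , ¬covered with Any.any? (_∈? V B) Q | meets? B C
  ...   | yes hit  | no ¬meet = B , B∈𝓑 , hit , ¬meet
  ...   | yes _    | yes meet = ⊥-elim (¬covered (λ _ → meet))
  ...   | no ¬hit  | _        = ⊥-elim (¬covered (⊥-elim ∘ ¬hit))

  Covers-++ : ∀ {C D Q R} → Covers C Q → Covers D R → Covers (C ∪ D) (Q ++ R)
  Covers-++ {C} {D} {Q} {R} C-covers D-covers = All.zipWith (λ {B} → combine {B}) (C-covers , D-covers)
    where
    combine : ∀ {B} → (Any (_∈ V B) Q → Meets B C) × (Any (_∈ V B) R → Meets B D) →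
              Any (_∈ V B) (Q ++ R) → Meets B (C ∪ D)
    combine (f , g) hit with Any.++⁻ Q hit
    ... | inj₁ hitQ = let x , x∈C , x∈B = f hitQ in x , p⊆p∪q D x∈C , x∈B
    ... | inj₂ hitR = let x , x∈D , x∈B = g hitR in x , q⊆p∪q C D x∈D , x∈B

  Covers-[x] : ∀ x → Covers ⁅ x ⁆ (x ∷ [])
  Covers-[x] x = All.tabulate λ { _ (here x∈B) → x , x∈⁅x⁆ x , x∈B }

  Heavy-++⁻ʳ : ∀ {C Q R} i j → Covers C Q → ∣ C ∣ ≤ i → Heavy (i + j) (Q ++ R) → Heavy j R
  Heavy-++⁻ʳ {C} i j C-covers ∣C∣≤i heavy D ∣D∣<j D-covers =
    heavy (C ∪ D) (≤-<-trans (∣p∪q∣≤∣p∣+∣q∣ C D) (+-mono-≤-< ∣C∣≤i ∣D∣<j)) (Covers-++ C-covers D-covers)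

  Heavy-∷⁻ : ∀ {m x Q} → Heavy (suc m) (x ∷ Q) → Heavy m Q
  Heavy-∷⁻ {m} {x} = Heavy-++⁻ʳ 1 m (Covers-[x] x) (≤-reflexive (∣⁅x⁆∣≡1 x))

  Heavy-mono : ∀ {i j Q} → i ≤ j → Heavy j Q → Heavy i Q
  Heavy-mono i≤j heavy C ∣C∣<i = heavy C (<-≤-trans ∣C∣<i i≤j)

  Light-[] : ∀ {k} → Light (suc k) []
  Light-[] {k} = Sub.⊥ , subst (_< suc k) (sym (∣⊥∣≡0 n)) (s≤s z≤n) , All.tabulate λ _ ()

  ¬Heavy-[] : ∀ {m} → ¬ Heavy (suc m) []
  ¬Heavy-[] heavy = let C , ∣C∣<1+m , C-covers = Light-[] in heavy C ∣C∣<1+m C-covers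

  first-heavy-prefix : ∀ {k} acc Q → Light k acc → Heavy k (acc ++ Q) →
    ∃[ T ] ∃[ x ] ∃[ Q′ ] (acc ++ Q ≡ T ++ x ∷ Q′ × Light k T × Heavy k (T ++ x ∷ []))
  first-heavy-prefix acc [] (C , ∣C∣<k , C-covers) heavy =
    ⊥-elim (heavy C ∣C∣<k (subst (Covers C) (sym (++-identityʳ acc)) C-covers))
  first-heavy-prefix {k} acc (x ∷ Q) light heavy with light? k (acc ++ x ∷ [])
  ... | no ¬light = acc , x , Q , refl , light , λ C ∣C∣<k C-covers → ¬light (C , ∣C∣<k , C-covers)
  ... | yes light′ with first-heavy-prefix (acc ++ x ∷ []) Q light′ (subst (Heavy k) acc·x·Q heavy)
    where
    acc·x·Q : acc ++ x ∷ Q ≡ (acc ++ x ∷ []) ++ Q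
    acc·x·Q = sym (++-assoc acc (x ∷ []) Q)
  ...   | T , y , Q′ , eq , light-T , heavy-T·y =
    T , y , Q′ , trans (sym (++-assoc acc (x ∷ []) Q)) eq , light-T , heavy-T·y

  split-heavy : ∀ k m Q → Heavy (suc k + m) Q →
    ∃[ T ] ∃[ a ] ∃[ Q′ ] (Q ≡ T ++ a ∷ Q′ × Heavy k T × Heavy m Q′)
  split-heavy zero m []      heavy = ⊥-elim (¬Heavy-[] heavy)
  split-heavy zero m (a ∷ Q) heavy = [] , a , Q , refl , (λ _ ()) , Heavy-∷⁻ heavy
  split-heavy (suc k) m Q heavy
    with first-heavy-prefix [] Q Light-[] (Heavy-mono (≤-trans (n≤1+n (suc k)) (m≤m+n (suc (suc k)) m)) heavy)
  ... | T , x , Q′ , refl , (C , ∣C∣<1+k , C-covers) , heavy-T·x = peel Q′ refl heavy-Q′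
    where
    heavy-Q′ : Heavy (suc m) Q′
    heavy-Q′ = Heavy-++⁻ʳ (suc k) (suc m) (Covers-++ C-covers (Covers-[x] x))
                 (≤-trans (∣p∪⁅x⁆∣≤1+∣p∣ C x) ∣C∣<1+k)
                 (subst₂ Heavy (sym (+-suc (suc k) m)) (sym (++-assoc T (x ∷ []) Q′)) heavy)
    peel : ∀ Q″ → Q′ ≡ Q″ → Heavy (suc m) Q″ →
           ∃[ T′ ] ∃[ a ] ∃[ Q‴ ] (T ++ x ∷ Q′ ≡ T′ ++ a ∷ Q‴ × Heavy (suc k) T′ × Heavy m Q‴)
    peel []       _    heavy′ = ⊥-elim (¬Heavy-[] heavy′)
    peel (a ∷ Q‴) refl heavy′ =
      T ++ x ∷ [] , a , Q‴ , sym (++-assoc T (x ∷ []) (a ∷ Q‴)) , heavy-T·x , Heavy-∷⁻ heavy′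

  record Decomposition (k j : ℕ) (Q : List (Fin n)) : Set where
    field
      T₀           : List (Fin n)
      pieces       : List (Piece n)
      Q≡           : Q ≡ T₀ ++ flatten pieces
      T₀-heavy     : Heavy k T₀
      pieces-heavy : All (Heavy k ∘ proj₂) pieces
      #pieces      : length pieces ≡ j

  decompose : ∀ k j Q → Heavy (j * suc k + k) Q → Decomposition k j Q
  decompose k zero Q heavy = record
    { T₀ = Q ; pieces = [] ; Q≡ = sym (++-identityʳ Q)
    ; T₀-heavy = heavy ; pieces-heavy = [] ; #pieces = refl }
  decompose k (suc j) Q heavy
    with split-heavy k (j * suc k + k) Q (subst (λ i → Heavy i Q) (+-assoc (suc k) (j * suc k) k) heavy)
  ... | T , a , Q′ , refl , heavy-T , heavy-Q′ = record
    { T₀ = T ; pieces = (a , D.T₀) ∷ D.pieces ; Q≡ = cong (λ R → T ++ a ∷ R) D.Q≡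
    ; T₀-heavy = heavy-T ; pieces-heavy = D.T₀-heavy ∷ D.pieces-heavy ; #pieces = cong suc D.#pieces }
    where module D = Decomposition (decompose k j Q′ heavy-Q′)

  meets-all⇒Heavy : ∀ {m Q} → HasOrder G 𝓑 m → (∀ B → B ∈ₗ 𝓑 → Any (_∈ V B) Q) → Heavy m Q
  meets-all⇒Heavy (_ , minimal) Q-meets-𝓑 C ∣C∣<m C-covers =
    <⇒≱ ∣C∣<m (minimal C λ B B∈𝓑 → All.lookup C-covers B∈𝓑 (Q-meets-𝓑 B B∈𝓑))

  Heavy⇒avoiding-element : ∀ {k S T} → Heavy k T → ∣ S ∣ < k →
                           ∃[ B ] ∃[ w ] (B ∈ₗ 𝓑 × ¬ Meets B S × w ∈ₗ T × w ∈ V B)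
  Heavy⇒avoiding-element {S = S} heavy ∣S∣<k with uncovered (heavy S ∣S∣<k)
  ... | B , B∈𝓑 , hit , ¬meet = let w , w∈T , w∈B = find hit in B , w , B∈𝓑 , ¬meet , w∈T , w∈B

  module _ (bramble : IsBramble G 𝓑) {S : Subset n} where

    walk-inside : ∀ {B} → B ∈ₗ 𝓑 → ¬ Meets B S → ∀ {x y} → x ∈ V B → y ∈ V B → Walk (Edge G) (_∉ S) x y
    walk-inside B∈𝓑 ¬meet x∈B y∈B =
      Reach⇒Walk G (λ z∈B z∈S → ¬meet (_ , z∈S , z∈B)) x∈B (proj₂ (All.lookup (proj₁ bramble) B∈𝓑) _ _ x∈B y∈B)

    walk-between : ∀ {B B′} → B ∈ₗ 𝓑 → B′ ∈ₗ 𝓑 → ¬ Meets B S → ¬ Meets B′ S →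
                   ∀ {w w′} → w ∈ V B → w′ ∈ V B′ → Walk (Edge G) (_∉ S) w w′
    walk-between {B} {B′} B∈𝓑 B′∈𝓑 ¬meet ¬meet′ w∈B w′∈B′ with proj₂ bramble B B′ B∈𝓑 B′∈𝓑
    ... | inj₁ (z , z∈B , z∈B′) =
      walk-inside B∈𝓑 ¬meet w∈B z∈B ++ʷ walk-inside B′∈𝓑 ¬meet′ z∈B′ w′∈B′
    ... | inj₂ ((b , b′ , b∈B , b′∈B′ , bb′) , _) =
      walk-inside B∈𝓑 ¬meet w∈B b∈B ++ʷ
      cons (λ b∈S → ¬meet (b , b∈S , b∈B)) bb′ (walk-inside B′∈𝓑 ¬meet′ b′∈B′ w′∈B′)

  module WellLinkedness (bramble : IsBramble G 𝓑) {k} (P : Path G) (D : Decomposition k k (verts G P)) where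

    open Decomposition D

    heads : List (Fin n)
    heads = map proj₁ pieces

    A : Subset n
    A = fromList heads

    private
      P! : Unique (T₀ ++ flatten pieces)
      P! = subst Unique Q≡ (unique P)

      P-linked : Linked (Edge G) (T₀ ++ flatten pieces)
      P-linked = subst (Linked (Edge G)) Q≡ (linked P)

      pieces# : AllPairs _#ᵖ_ pieces
      pieces# = pieces-disjoint pieces (proj₁ (proj₂ (Unique-++⁻ T₀ P!)))

      heads⊆flatten : ∀ (ps : List (Piece n)) {x} → x ∈ₗ map proj₁ ps → x ∈ₗ flatten ps
      heads⊆flatten ((a , T) ∷ ps) (here refl) = here refl
      heads⊆flatten ((a , T) ∷ ps) (there x∈)  = there (∈-++⁺ʳ T (heads⊆flatten ps x∈))

    A⊆P : ∀ v → v ∈ A → v ∈ₗ verts G P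
    A⊆P v v∈A = subst (v ∈ₗ_) (sym Q≡) (∈-++⁺ʳ T₀ (heads⊆flatten pieces (∈-fromList⁻ heads v∈A)))

    ∣A∣≡k : ∣ A ∣ ≡ k
    ∣A∣≡k = begin-equality
      ∣ A ∣          ≡⟨ ≤-antisym (∣fromList∣≤length heads)
                           (Unique⇒length≤∣p∣ A heads! (All.tabulate (∈-fromList⁺ heads))) ⟩
      length heads   ≡⟨ length-map proj₁ pieces ⟩
      length pieces  ≡⟨ #pieces ⟩
      k              ∎
      where
      open ≤-Reasoning
      heads! : Unique heads
      heads! = AllPairs.map⁺ (AllPairs.map (λ p#q e → p#q (here refl , here e)) pieces#)

    module _ {S : Subset n} where

      ExitFrom EntryTo : Subset n → Set
      ExitFrom X = ∃[ x ] ∃[ B ] ∃[ w ] (x ∈ X × B ∈ₗ 𝓑 × ¬ Meets B S × w ∈ V B × Walk (Edge G) (_∉ S) x w)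
      EntryTo  Y = ∃[ y ] ∃[ B ] ∃[ w ] (y ∈ Y × B ∈ₗ 𝓑 × ¬ Meets B S × w ∈ V B × Walk (Edge G) (_∉ S) w y)

      exit : ∀ {X} → X ⊆ₛ A → ∣ S ∣ < ∣ X ∣ → ∣ S ∣ < k → ExitFrom X
      exit {X} X⊆A ∣S∣<∣X∣ ∣S∣<k
        with clear-piece X S pieces pieces# (∈-fromList⁻ heads ∘ X⊆A) ∣S∣<∣X∣
      ... | (a , T) , p∈ , a∈X , a·T∉S with Heavy⇒avoiding-element (All.lookup pieces-heavy p∈) ∣S∣<k
      ...   | B , w , B∈𝓑 , ¬meet , w∈T , w∈B =
        a , B , w , a∈X , B∈𝓑 , ¬meet , w∈B , walk-prefix a T a·T-linked a·T∉S (there w∈T)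
        where
        a·T-linked : Linked (Edge G) (a ∷ T)
        a·T-linked = All.lookup (pieces-linked pieces (Linked-++⁻ʳ T₀ P-linked)) p∈

      entry : ∀ {Y} → Y ⊆ₛ A → ∣ S ∣ < ∣ Y ∣ → ∣ S ∣ < k → EntryTo Y
      entry {Y} Y⊆A ∣S∣<∣Y∣ ∣S∣<k
        with clear-piece Y S (backward T₀ pieces) (backward-disjoint T₀ pieces P!) Y⊆heads ∣S∣<∣Y∣
        where
        Y⊆heads : ∀ {y} → y ∈ Y → y ∈ₗ map proj₁ (backward T₀ pieces)
        Y⊆heads y∈Y = subst (_ ∈ₗ_) (sym (heads-backward T₀ pieces)) (∈-fromList⁻ heads (Y⊆A y∈Y))
      ... | (a , T) , p∈ , a∈Y , a∉S ∷ T∉S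
        with Heavy⇒avoiding-element (All.lookup (backward-All pieces T₀-heavy pieces-heavy) p∈) ∣S∣<k
      ...   | B , w , B∈𝓑 , ¬meet , w∈T , w∈B =
        a , B , w , a∈Y , B∈𝓑 , ¬meet , w∈B , walk-to-last T T·a-linked (All.++⁺ T∉S (a∉S ∷ [])) w∈T
        where
        T·a-linked : Linked (Edge G) (T ++ a ∷ [])
        T·a-linked = All.lookup (backward-linked T₀ pieces P-linked) p∈

      crossing-walk : ∀ {X Y} → X ⊆ₛ A → Y ⊆ₛ A → ∣ S ∣ < ∣ X ∣ → ∣ X ∣ ≡ ∣ Y ∣ →
                      ∃[ x ] ∃[ y ] (x ∈ X × y ∈ Y × Walk (Edge G) (_∉ S) x y)
      crossing-walk X⊆A Y⊆A ∣S∣<∣X∣ ∣X∣≡∣Y∣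
        with exit X⊆A ∣S∣<∣X∣ ∣S∣<k | entry Y⊆A (subst (∣ S ∣ <_) ∣X∣≡∣Y∣ ∣S∣<∣X∣) ∣S∣<k
        where
        ∣S∣<k : ∣ S ∣ < k
        ∣S∣<k = <-≤-trans ∣S∣<∣X∣ (≤-trans (p⊆q⇒∣p∣≤∣q∣ X⊆A) (≤-reflexive ∣A∣≡k))
      ... | x , B , w , x∈X , B∈𝓑 , ¬meet , w∈B , W | y , B′ , w′ , y∈Y , B′∈𝓑 , ¬meet′ , w′∈B′ , W′ =
        x , y , x∈X , y∈Y , W ++ʷ (walk-between bramble B∈𝓑 B′∈𝓑 ¬meet ¬meet′ w∈B w′∈B′ ++ʷ W′)

    well-linked : WellLinked G A
    well-linked X Y X⊆A Y⊆A ∣X∣≡∣Y∣ with menger (edges G) X Y ∣ X ∣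
    ... | inj₁ L                    = toLinkage G L
    ... | inj₂ (S , ∣S∣<∣X∣ , sep) =
      let x , y , x∈X , y∈Y , W = crossing-walk X⊆A Y⊆A ∣S∣<∣X∣ ∣X∣≡∣Y∣
      in ⊥-elim (sep x∈X y∈Y (Walk-map (edges-complete G) id W))

lemma4p4 : ∀ {n} (G : Digraph n) (k : ℕ) (𝓑 : List (Subgraph G)) (P : Path G) →
    IsBramble G 𝓑 → HasOrder G 𝓑 (k * (k + 2)) →
    (∀ B → B ∈ₗ 𝓑 → ∃[ v ] (v ∈ V B × v ∈ₗ verts G P)) →
    ∃[ A ] ((∀ v → v ∈ A → v ∈ₗ verts G P) × ∣ A ∣ ≡ k × WellLinked G A)
lemma4p4 G k 𝓑 P bramble order P-meets-𝓑 = A , A⊆P , ∣A∣≡k , well-linked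
  where
  open Bramble G 𝓑

  k[k+2]≡k[k+1]+k : k * (k + 2) ≡ k * suc k + k
  k[k+2]≡k[k+1]+k = begin
    k * (k + 2)     ≡⟨ cong (k *_) (+-comm k 2) ⟩
    k * suc (suc k) ≡⟨ *-suc k (suc k) ⟩
    k + k * suc k   ≡⟨ +-comm k (k * suc k) ⟩
    k * suc k + k   ∎
    where open ≡-Reasoning

  P-heavy : Heavy (k * suc k + k) (verts G P)
  P-heavy = subst (λ m → Heavy m (verts G P)) k[k+2]≡k[k+1]+k
    (meets-all⇒Heavy order λ B B∈𝓑 → let _ , v∈B , v∈P = P-meets-𝓑 B B∈𝓑 in lose v∈P v∈B)

  open WellLinkedness bramble P (decompose k k (verts G P) P-heavy)
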